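{- Let $G=(F,V,E)$ be a bipartite factor graph in which every check node has degree at least $2$, with adjacency matrix $\mathbb{H}\in\{0,1\}^{F\times V}$, and let $G_*=(F_*,V_*,E_*)$ be its collapsed graph with adjacency matrix $\mathbb{Q}\in\{0,1\}^{F_*\times V_*}$. Assume $G_*$ has no $2$-core, and let $U_*,W_*\subseteq V_*$ be obtained from synchronous peeling of $G_*$ as described in the context. Then the columns of $$\mathbb{L}\left[\begin{array}{c}(\mathbb{Q}_{F_*,U_*})^{ -1}\mathbb{Q}_{F_*,W_*} \\ I_{(n_*-m_*) \times (n_*-m_*)}\end{array}\right]$$ (where rows are indexed by $U_*$ followed by $W_*$, and the inverse is over $\mathrm{GF}(2)$) form an $s$-sparse basis of the kernel of $\mathbb{H}$ over $\mathrm{GF}(2)$, with $s = \max_{v_*\in V_*}S(v_*,T_{\rm C}(G_*))$.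
   Context: Collapsed graph: let $G^{(2)}$ be the subgraph of $G$ consisting of all variable nodes $V$, the check nodes of degree exactly $2$, and their edges. $F_*=\{a\in F: |\partial a|\ge 3\}$; $V_*$ is the set of connected components of $G^{(2)}$, each viewed as a set of variable nodes ("super-nodes"); $E_*=\{(S,a): a\in F_*,\ |\{i\in S: (i,a)\in E\}|\text{ is odd}\}$; $n_*=|V_*|$, $m_*=|F_*|$. $\mathbb{L}\in\{0,1\}^{V\times V_*}$ has $\mathbb{L}_{i,v}=1$ iff $i\in v$. For $v\in V_*$, $S(v)=|v|$, and $S(v,t)=\sum_{w\in \mathsf{B}_{G_*}(v,t)}S(w)$, where $\mathsf{B}_{G_*}(v,t)$ is the set of super-nodes at distance at most $t$ from $v$ in $G_*$ (path length = number of check nodes on the path). For a matrix $\mathbb{M}$, $\mathbb{M}_{A,B}$ is its submatrix with rows $A$ and columns $B$. Synchronous peeling of a factor graph $H$: $J_0=H$; for $t=1,2,\dots$, while $J_{t-1}$ has a variable node of degree $\le 1$, let $V_t$ be the variable nodes of degree $\le1$ in $J_{t-1}$, $F_t$ the check nodes of $J_{t-1}$ adjacent to some node of $V_t$, and $J_t$ the graph obtained from $J_{t-1}$ by deleting $V_t$, $F_t$ and all edges incident to $F_t$. $T_{\rm C}(H)$ is the number of rounds performed; the final graph is the $2$-core of $H$ (its maximal check-induced subgraph in which all variable nodes have degree $\ge2$); "$H$ has no $2$-core" means the final graph is empty. $U_*,W_*$: apply peeling to $G_*$; for each round $t$ and each check $a\in F_t$, choose (by a fixed rule) one variable $u_a\in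 V_t$ adjacent to $a$ in $J_{t-1}$ with degree exactly $1$ in $J_{t-1}$ (such exists); $U_*=\{u_a\}$ and $W_*=V_*\setminus U_*$. An $s$-sparse basis of a linear subspace is a basis consisting of vectors of Hamming weight at most $s$. -}

module Defs where

open import Data.Bool using (Bool; true; false; _∧_; _∨_; _xor_; not; if_then_else_)
open import Data.Nat using (ℕ; zero; suc; _+_; _≤_; _<_; _⊔_; _≤ᵇ_)
open import Data.Fin using (Fin; zero; suc)
open import Data.Fin.Properties using (_≟_)
open import Data.Product using (Σ; ∃; _×_; _,_)
open import Relation.Nullary.Decidable using (⌊_⌋)
open import Relation.Binary.PropositionalEquality using (_≡_)
open import Relation.Binary.Construct.Closure.ReflexiveTransitive using (Star)

-- Finite folds over Fin k.  Vectors / matrices over GF(2) are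
-- functions into Bool (false = 0, true = 1, _xor_ = +, _∧_ = *).

xorSum : ∀ {k} → (Fin k → Bool) → Bool
xorSum {zero}  f = false
xorSum {suc k} f = f zero xor xorSum (λ i → f (suc i))

natSum : ∀ {k} → (Fin k → ℕ) → ℕ
natSum {zero}  f = 0
natSum {suc k} f = f zero + natSum (λ i → f (suc i))

count : ∀ {k} → (Fin k → Bool) → ℕ
count f = natSum (λ i → if f i then 1 else 0)

-- max_{i : Fin k} f i  (0 for k = 0)
maxOver : ∀ {k} → (Fin k → ℕ) → ℕ
maxOver {zero}  f = 0
maxOver {suc k} f = f zero ⊔ maxOver (λ i → f (suc i))

anyFin : ∀ {k} → (Fin k → Bool) → Bool
anyFin {zero}  f = false
anyFin {suc k} f = f zero ∨ anyFin (λ i → f (suc i))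

δ : ∀ {k} → Fin k → Fin k → Bool
δ i j = ⌊ i ≟ j ⌋

_⊛_ : ∀ {p q r} → (Fin p → Fin q → Bool) → (Fin q → Fin r → Bool) → Fin p → Fin r → Bool
(A ⊛ B) i k = xorSum (λ j → A i j ∧ B j k)

-- Factor graph G = (F, V, E) with F = Fin m, V = Fin n, given by its
-- adjacency matrix H ∈ {0,1}^{F×V}:  (a,i) ∈ E  iff  H a i ≡ true.

checkDeg : ∀ {m n} → (Fin m → Fin n → Bool) → Fin m → ℕ
checkDeg H a = count (H a)

-- i, j joined through a check of degree exactly 2 (an edge path of G^(2))
Adj2 : ∀ {m n} → (Fin m → Fin n → Bool) → Fin n → Fin n → Set
Adj2 H i j = ∃ λ a → checkDeg H a ≡ 2 × H a i ≡ true × H a j ≡ true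

Conn2 : ∀ {m n} → (Fin m → Fin n → Bool) → Fin n → Fin n → Set
Conn2 H = Star (Adj2 H)

InKer : ∀ {m n} → (Fin m → Fin n → Bool) → (Fin n → Bool) → Set
InKer H y = ∀ a → xorSum (λ i → H a i ∧ y i) ≡ false

-- V_* = connected components of G^(2), represented by a labelling
--   comp : V → Fin nS  whose fibres are exactly the components
--   (so Fin nS ≅ V_*, and L_{i,v} = 1 iff comp i ≡ v);
-- F_* = checks of degree ≥ 3, enumerated injectively by fS : Fin mS → F.
-- E_* / Q : (S,a) edge iff |{i ∈ S : (i,a) ∈ E}| odd.

record Collapsed {m n} (H : Fin m → Fin n → Bool) : Set where
  field
    nS        : ℕ
    comp      : Fin n → Fin nS
    comp-surj : ∀ v → ∃ λ i → comp i ≡ v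
    comp-sound : ∀ i j → comp i ≡ comp j → Conn2 H i j
    comp-complete : ∀ i j → Conn2 H i j → comp i ≡ comp j
    mS        : ℕ
    fS        : Fin mS → Fin m
    fS-inj    : ∀ a b → fS a ≡ fS b → a ≡ b
    fS-deg    : ∀ b → 3 ≤ checkDeg H (fS b)
    fS-all    : ∀ a → 3 ≤ checkDeg H a → ∃ λ b → fS b ≡ a

  L : Fin n → Fin nS → Bool
  L i v = ⌊ comp i ≟ v ⌋

  Q : Fin mS → Fin nS → Bool
  Q a v = xorSum (λ i → H (fS a) i ∧ L i v)

  size : Fin nS → ℕ
  size v = count (λ i → L i v)

module FactorGraph {mm nn : ℕ} (Q : Fin mm → Fin nn → Bool) where

  -- ball B(v,t): super-nodes at distance ≤ t (distance = #checks on a path)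
  ball : Fin nn → ℕ → Fin nn → Bool
  ball v zero    w = δ v w
  ball v (suc t) w = ball v t w ∨ anyFin (λ a → Q a w ∧ anyFin (λ w' → ball v t w' ∧ Q a w'))

  -- state of peeling: alive variable nodes and alive check nodes
  -- (the current graph J_t is the subgraph of the original induced by them)
  State : Set
  State = (Fin nn → Bool) × (Fin mm → Bool)

  aliveV : State → Fin nn → Bool
  aliveV (α , β) = α

  aliveC : State → Fin mm → Bool
  aliveC (α , β) = β

  vdeg : State → Fin nn → ℕ
  vdeg st v = count (λ a → aliveC st a ∧ Q a v)

  inVt : State → Fin nn → Bool
  inVt st v = aliveV st v ∧ (vdeg st v ≤ᵇ 1)

  inFt : State → Fin mm → Bool
  inFt st a = aliveC st a ∧ anyFin (λ v → inVt st v ∧ Q a v)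

  step : State → State
  step st = (λ v → aliveV st v ∧ not (inVt st v)) , (λ a → aliveC st a ∧ not (inFt st a))

  J : ℕ → State
  J zero    = (λ _ → true) , (λ _ → true)
  J (suc t) = step (J t)

  hasLeaf : State → Bool
  hasLeaf st = anyFin (inVt st)

  IsTC : ℕ → Set
  IsTC T = (∀ t → t < T → hasLeaf (J t) ≡ true) × hasLeaf (J T) ≡ false

  NoCore : ℕ → Set
  NoCore T = (∀ v → aliveV (J T) v ≡ false) × (∀ a → aliveC (J T) a ≡ false)

  -- u is an admissible choice a ↦ u_a: a ∈ F_{t+1} (round t+1 acts on J_t),
  -- u_a ∈ V_{t+1} adjacent to a in J_t with degree exactly 1 in J_t.
  ValidChoice : ℕ → (Fin mm → Fin nn) → Set
  ValidChoice T u = ∀ a → ∃ λ t → t < T × inFt (J t) a ≡ true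
                      × inVt (J t) (u a) ≡ true × Q a (u a) ≡ true × vdeg (J t) (u a) ≡ 1

module Lemma {m n} (H : Fin m → Fin n → Bool) (C : Collapsed H) where
  open Collapsed C public
  open FactorGraph Q public

  S : Fin nS → ℕ → ℕ
  S v t = natSum (λ w → if ball v t w then size w else 0)

  sBound : ℕ → ℕ
  sBound T = maxOver (λ v → S v T)

  module Choice (u : Fin mS → Fin nS) where
    inU : Fin nS → Bool
    inU v = anyFin (λ a → ⌊ u a ≟ v ⌋)

    inW : Fin nS → Bool
    inW v = not (inU v)

    -- Q_{F_*,U_*}, columns ordered via u (column b ↔ super-node u b)
    QU : Fin mS → Fin mS → Bool
    QU a b = Q a (u b)

    -- Given M = (Q_{F_*,U_*})⁻¹ (rows indexed via u), the column of
    -- [ M Q_{F_*,W_*} ; I ] belonging to w ∈ W_*, as a vector in GF(2)^{V_*}: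
    --   e_w + Σ_b (M Q)_{b,w} e_{u b}
    xcol : (Fin mS → Fin mS → Bool) → Fin nS → Fin nS → Bool
    xcol M w v = δ w v xor xorSum (λ b → ⌊ u b ≟ v ⌋ ∧ (M ⊛ Q) b w)

    col : (Fin mS → Fin mS → Bool) → Fin nS → Fin n → Bool
    col M w i = xorSum (λ v → L i v ∧ xcol M w v)

    SparseKernelBasis : (Fin mS → Fin mS → Bool) → ℕ → Set
    SparseKernelBasis M s =
        (∀ w → inW w ≡ true → InKer H (col M w))
      × (∀ (c : Fin nS → Bool) →
           (∀ i → xorSum (λ w → inW w ∧ c w ∧ col M w i) ≡ false) →
           ∀ w → inW w ≡ true → c w ≡ false)
      × (∀ y → InKer H y → ∃ λ (c : Fin nS → Bool) →
           ∀ i → y i ≡ xorSum (λ w → inW w ∧ c w ∧ col M w i))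
      × (∀ w → inW w ≡ true → count (col M w) ≤ s)

module Submission where

-- A check adjacent to the leaf u_b chosen
--    for another check b is peeled strictly before b.  So Q_U = I + N with N
--    strictly triangular for the peeling rounds; hence N^T = 0 and the
--    Neumann sum M = I + N + … + N^(T-1) is a two-sided inverse of Q_U.
--    Unrolling the same sum shows (M Q)_{b,w} ≠ 0 only if u_b lies within
--    distance T of w, so every basis column is supported in B(w,T).
--  * Systematic basis (SystematicBasis).  For any GF(2) matrix Q whose
--    columns U form an invertible block with inverse M, the columns of
--    [M Q_W ; I] form a basis of ker Q.  Spreading by 𝕃 keeps the basis property, and a column
--    supported in B(w,T) spreads to weight at most S(w,T).

open import Defs
open import Data.Bool using (Bool; true; false; _∧_; _∨_; _xor_; not; if_then_else_)
open import Data.Bool.Properties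
  using (xor-∧-commutativeRing; ∧-commutativeMonoid; ∧-distribˡ-xor; ∧-distribʳ-xor; ∧-assoc; ∧-comm; ∧-zeroʳ; ∧-identityʳ;
         xor-assoc; xor-same; xor-identityʳ; ∨-zeroʳ)
open import Data.Nat using (ℕ; zero; suc; _+_; _≤_; _<_; z≤n; s≤s; _≤?_; _≤′_; ≤′-refl; ≤′-step)
open import Data.Nat.Properties using (≤-antisym; ≤-pred; ≤⇒≤′; ≰⇒>; ≤-refl; ≤-trans; ≤-<-trans; <-irrefl; +-suc; +-identityʳ; +-monoˡ-≤; m≤n+m; module ≤-Reasoning; suc-injective; +-0-commutativeMonoid; +-mono-≤; m≤m⊔n; m≤n⇒m≤o⊔n)
open import Data.Fin using (Fin; zero; suc; punchIn; punchOut)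
open import Data.Fin.Properties using (_≟_; punchInᵢ≢i; punchIn-punchOut; punchIn-injective; punchOut-injective)
open import Data.Product using (Σ; ∃; _×_; _,_; proj₁; proj₂)
open import Data.Sum using (_⊎_; inj₁; inj₂)
open import Data.Empty using (⊥-elim)
open import Relation.Nullary using (¬_; yes; no)
open import Relation.Nullary.Decidable using (⌊_⌋)
open import Relation.Binary.Construct.Closure.ReflexiveTransitive using (ε; _◅_)
open import Relation.Binary.PropositionalEquality using (_≡_; _≢_; refl; sym; trans; cong; cong₂; subst; module ≡-Reasoning)
open import Level using (0ℓ)
open import Algebra.Bundles using (CommutativeMonoid; CommutativeRing)
open import Algebra.Properties.CommutativeSemigroup (CommutativeMonoid.commutativeSemigroup ∧-commutativeMonoid)
  using () renaming (x∙yz≈y∙xz to ∧-left-comm; x∙yz≈z∙xy to ∧-rotate)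

module SingleTerm {c ℓ} (M : CommutativeMonoid c ℓ) where
  open CommutativeMonoid M renaming (ε to 0#)
  open import Algebra.Properties.CommutativeMonoid.Sum M using (sum; sum-remove; sum-cong-≋; sum-replicate-zero)
  open import Relation.Binary.Reasoning.Setoid setoid

  sum-single : ∀ {k} (t : Fin k → Carrier) i → (∀ j → j ≢ i → t j ≈ 0#) → sum t ≈ t i
  sum-single {suc k} t i vanish = begin
    sum t                             ≈⟨ sum-remove t ⟩
    t i ∙ sum (λ j → t (punchIn i j))  ≈⟨ ∙-congˡ (sum-cong-≋ (λ j → vanish (punchIn i j) (punchInᵢ≢i i j))) ⟩
    t i ∙ sum {k} (λ _ → 0#)          ≈⟨ ∙-congˡ (sum-replicate-zero k) ⟩
    t i ∙ 0#                          ≈⟨ identityʳ (t i) ⟩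
    t i                               ∎

module BoolFacts where
  ∧-true : ∀ {x y} → x ∧ y ≡ true → x ≡ true × y ≡ true
  ∧-true {true} {true} _ = refl , refl

  ∨-true : ∀ {x y} → x ∨ y ≡ true → x ≡ true ⊎ y ≡ true
  ∨-true {true}  _   = inj₁ refl
  ∨-true {false} y≡1 = inj₂ y≡1

  xor-true : ∀ {x y} → x xor y ≡ true → x ≡ true ⊎ y ≡ true
  xor-true {true}  _   = inj₁ refl
  xor-true {false} y≡1 = inj₂ y≡1

  xor-false⇒≡ : ∀ {x y} → x xor y ≡ false → x ≡ y
  xor-false⇒≡ {false} x⊕y≡0 = sym x⊕y≡0
  xor-false⇒≡ {true}  {true} _ = refl

open BoolFacts

module AnyFin where
  anyFin-intro : ∀ {k} (f : Fin k → Bool) i → f i ≡ true → anyFin f ≡ true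
  anyFin-intro f zero    fi rewrite fi = refl
  anyFin-intro f (suc i) fi rewrite anyFin-intro (λ j → f (suc j)) i fi = ∨-zeroʳ (f zero)

  anyFin-witness : ∀ {k} (f : Fin k → Bool) → anyFin f ≡ true → ∃ λ i → f i ≡ true
  anyFin-witness {suc k} f any≡1 with ∨-true any≡1
  ... | inj₁ f0 = zero , f0
  ... | inj₂ rest with anyFin-witness (λ i → f (suc i)) rest
  ...   | i , fi = suc i , fi

  anyFin-none : ∀ {k} (f : Fin k → Bool) → anyFin f ≡ false → ∀ i → f i ≡ false
  anyFin-none f any≡0 i with f i in fi
  ... | false = refl
  ... | true  = trans (sym (anyFin-intro f i fi)) any≡0

open AnyFin

module Delta where
  δ-refl : ∀ {k} (i : Fin k) → δ i i ≡ true
  δ-refl i with i ≟ i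
  ... | yes _  = refl
  ... | no i≢i = ⊥-elim (i≢i refl)

  δ-≢ : ∀ {k} {i j : Fin k} → i ≢ j → δ i j ≡ false
  δ-≢ {i = i} {j} i≢j with i ≟ j
  ... | yes i≡j = ⊥-elim (i≢j i≡j)
  ... | no _    = refl

  δ-sym : ∀ {k} (i j : Fin k) → δ i j ≡ δ j i
  δ-sym i j with i ≟ j | j ≟ i
  ... | yes _   | yes _   = refl
  ... | no _    | no _    = refl
  ... | yes i≡j | no j≢i  = ⊥-elim (j≢i (sym i≡j))
  ... | no i≢j  | yes j≡i = ⊥-elim (i≢j (sym j≡i))

  δ-true : ∀ {k} {i j : Fin k} → δ i j ≡ true → i ≡ j
  δ-true {i = i} {j} δij with i ≟ j
  ... | yes i≡j = i≡j

  not-δ⇒≢ : ∀ {k} {i j : Fin k} → not (δ i j) ≡ true → i ≢ j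
  not-δ⇒≢ {i = i} ¬δij refl with () ← trans (sym (cong not (δ-refl i))) ¬δij

open Delta

module GF2Sum where
  open CommutativeRing xor-∧-commutativeRing using (semiring; +-commutativeMonoid)
  open import Algebra.Properties.Semiring.Sum semiring using (sum; sum-cong-≗; sum-remove; ∑-distrib-+; ∑-comm; *-distribˡ-sum)
  open SingleTerm +-commutativeMonoid using (sum-single)

  xorSum≗sum : ∀ {k} (f : Fin k → Bool) → xorSum f ≡ sum f
  xorSum≗sum {zero}  f = refl
  xorSum≗sum {suc k} f = cong (f zero xor_) (xorSum≗sum (λ i → f (suc i)))

  xorSum-cong : ∀ {k} {f g : Fin k → Bool} → (∀ i → f i ≡ g i) → xorSum f ≡ xorSum g
  xorSum-cong {zero}  f≗g = refl
  xorSum-cong {suc k} f≗g = cong₂ _xor_ (f≗g zero) (xorSum-cong (λ i → f≗g (suc i)))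

  xorSum-false : ∀ {k} (f : Fin k → Bool) → (∀ i → f i ≡ false) → xorSum f ≡ false
  xorSum-false {zero}  f f≗0 = refl
  xorSum-false {suc k} f f≗0 rewrite f≗0 zero = xorSum-false (λ i → f (suc i)) (λ i → f≗0 (suc i))

  xorSum-true : ∀ {k} (f : Fin k → Bool) → xorSum f ≡ true → ∃ λ i → f i ≡ true
  xorSum-true {suc k} f sum≡1 with f zero in f0
  ... | true  = zero , f0
  ... | false with xorSum-true (λ i → f (suc i)) sum≡1
  ...   | i , fi = suc i , fi

  xorSum-xor : ∀ {k} (f g : Fin k → Bool) → xorSum (λ i → f i xor g i) ≡ xorSum f xor xorSum g
  xorSum-xor f g = begin
    xorSum (λ i → f i xor g i) ≡⟨ xorSum≗sum (λ i → f i xor g i) ⟩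
    sum (λ i → f i xor g i)    ≡⟨ ∑-distrib-+ f g ⟩
    sum f xor sum g            ≡⟨ sym (cong₂ _xor_ (xorSum≗sum f) (xorSum≗sum g)) ⟩
    xorSum f xor xorSum g      ∎
    where open ≡-Reasoning

  xorSum-∧ˡ : ∀ {k} x (f : Fin k → Bool) → xorSum (λ i → x ∧ f i) ≡ x ∧ xorSum f
  xorSum-∧ˡ x f = begin
    xorSum (λ i → x ∧ f i) ≡⟨ xorSum≗sum (λ i → x ∧ f i) ⟩
    sum (λ i → x ∧ f i)    ≡⟨ sym (*-distribˡ-sum x f) ⟩
    x ∧ sum f              ≡⟨ sym (cong (x ∧_) (xorSum≗sum f)) ⟩
    x ∧ xorSum f           ∎
    where open ≡-Reasoning

  xorSum-∧ʳ : ∀ {k} x (f : Fin k → Bool) → xorSum (λ i → f i ∧ x) ≡ xorSum f ∧ x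
  xorSum-∧ʳ x f = trans (xorSum-cong (λ i → ∧-comm (f i) x)) (trans (xorSum-∧ˡ x f) (∧-comm x (xorSum f)))

  xorSum-swap : ∀ {k l} (f : Fin k → Fin l → Bool) →
    xorSum (λ i → xorSum (f i)) ≡ xorSum (λ j → xorSum (λ i → f i j))
  xorSum-swap f = begin
    xorSum (λ i → xorSum (f i))         ≡⟨ xorSum≗sum (λ i → xorSum (f i)) ⟩
    sum (λ i → xorSum (f i))            ≡⟨ sum-cong-≗ (λ i → xorSum≗sum (f i)) ⟩
    sum (λ i → sum (f i))               ≡⟨ ∑-comm f ⟩
    sum (λ j → sum (λ i → f i j))       ≡⟨ sym (sum-cong-≗ (λ j → xorSum≗sum (λ i → f i j))) ⟩
    sum (λ j → xorSum (λ i → f i j))    ≡⟨ sym (xorSum≗sum (λ j → xorSum (λ i → f i j))) ⟩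
    xorSum (λ j → xorSum (λ i → f i j)) ∎
    where open ≡-Reasoning

  xorSum-single : ∀ {k} (f : Fin k → Bool) i → (∀ j → j ≢ i → f j ≡ false) → xorSum f ≡ f i
  xorSum-single f i vanish = trans (xorSum≗sum f) (sum-single f i vanish)

  xorSum-pair : ∀ {k} (f : Fin k → Bool) {i j} → i ≢ j → (∀ l → l ≢ i → l ≢ j → f l ≡ false) →
    xorSum f ≡ f i xor f j
  xorSum-pair {suc k} f {i} {j} i≢j vanish = begin
    xorSum f                                     ≡⟨ xorSum≗sum f ⟩
    sum f                                        ≡⟨ sum-remove f ⟩
    f i xor sum (λ l → f (punchIn i l))           ≡⟨ cong (f i xor_) (sym (xorSum≗sum (λ l → f (punchIn i l)))) ⟩
    f i xor xorSum (λ l → f (punchIn i l))        ≡⟨ cong (f i xor_) (xorSum-single _ (punchOut i≢j) rest-vanishes) ⟩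
    f i xor f (punchIn i (punchOut i≢j))          ≡⟨ cong (λ x → f i xor f x) (punchIn-punchOut i≢j) ⟩
    f i xor f j                                  ∎
    where
    open ≡-Reasoning
    rest-vanishes : ∀ l → l ≢ punchOut i≢j → f (punchIn i l) ≡ false
    rest-vanishes l l≢ = vanish (punchIn i l) (punchInᵢ≢i i l)
      (λ eq → l≢ (punchIn-injective i l (punchOut i≢j) (trans eq (sym (punchIn-punchOut i≢j)))))

  xorSum-δ : ∀ {k} (i : Fin k) (f : Fin k → Bool) → xorSum (λ j → δ i j ∧ f j) ≡ f i
  xorSum-δ i f = trans (xorSum-single _ i off-diagonal) (cong (_∧ f i) (δ-refl i))
    where
    off-diagonal : ∀ j → j ≢ i → δ i j ∧ f j ≡ false
    off-diagonal j j≢i = cong (_∧ f j) (δ-≢ (λ i≡j → j≢i (sym i≡j)))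

module NatSum where
  open import Algebra.Properties.CommutativeMonoid.Sum +-0-commutativeMonoid using (sum; sum-cong-≗; sum-remove; ∑-comm)
  open SingleTerm +-0-commutativeMonoid using (sum-single)

  natSum≗sum : ∀ {k} (f : Fin k → ℕ) → natSum f ≡ sum f
  natSum≗sum {zero}  f = refl
  natSum≗sum {suc k} f = cong (f zero +_) (natSum≗sum (λ i → f (suc i)))

  natSum-zero : ∀ {k} (f : Fin k → ℕ) → (∀ i → f i ≡ 0) → natSum f ≡ 0
  natSum-zero {zero}  f f≗0 = refl
  natSum-zero {suc k} f f≗0 rewrite f≗0 zero = natSum-zero (λ i → f (suc i)) (λ i → f≗0 (suc i))

  natSum-cong : ∀ {k} {f g : Fin k → ℕ} → (∀ i → f i ≡ g i) → natSum f ≡ natSum g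
  natSum-cong {zero}  f≗g = refl
  natSum-cong {suc k} f≗g = cong₂ _+_ (f≗g zero) (natSum-cong (λ i → f≗g (suc i)))

  natSum-mono : ∀ {k} {f g : Fin k → ℕ} → (∀ i → f i ≤ g i) → natSum f ≤ natSum g
  natSum-mono {zero}  f≤g = z≤n
  natSum-mono {suc k} f≤g = +-mono-≤ (f≤g zero) (natSum-mono (λ i → f≤g (suc i)))

  natSum-single : ∀ {k} (f : Fin k → ℕ) i → (∀ j → j ≢ i → f j ≡ 0) → natSum f ≡ f i
  natSum-single f i vanish = trans (natSum≗sum f) (sum-single f i vanish)

  natSum-swap : ∀ {k l} (f : Fin k → Fin l → ℕ) →
    natSum (λ i → natSum (f i)) ≡ natSum (λ j → natSum (λ i → f i j))
  natSum-swap f = begin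
    natSum (λ i → natSum (f i))         ≡⟨ natSum≗sum (λ i → natSum (f i)) ⟩
    sum (λ i → natSum (f i))            ≡⟨ sum-cong-≗ (λ i → natSum≗sum (f i)) ⟩
    sum (λ i → sum (f i))               ≡⟨ ∑-comm f ⟩
    sum (λ j → sum (λ i → f i j))       ≡⟨ sym (sum-cong-≗ (λ j → natSum≗sum (λ i → f i j))) ⟩
    sum (λ j → natSum (λ i → f i j))    ≡⟨ sym (natSum≗sum (λ j → natSum (λ i → f i j))) ⟩
    natSum (λ j → natSum (λ i → f i j)) ∎
    where open ≡-Reasoning

  maxOver-≥ : ∀ {k} (f : Fin k → ℕ) i → f i ≤ maxOver f
  maxOver-≥ f zero    = m≤m⊔n (f zero) _
  maxOver-≥ f (suc i) = m≤n⇒m≤o⊔n (f zero) (maxOver-≥ (λ j → f (suc j)) i)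

  ind : Bool → ℕ
  ind b = if b then 1 else 0

  count-mono : ∀ {k} {f g : Fin k → Bool} → (∀ i → f i ≡ true → g i ≡ true) → count f ≤ count g
  count-mono {f = f} {g} f⊆g = natSum-mono (λ i → ind-mono (f i) (g i) (f⊆g i))
    where
    ind-mono : ∀ a b → (a ≡ true → b ≡ true) → ind a ≤ ind b
    ind-mono false b _    = z≤n
    ind-mono true  b a⇒b rewrite a⇒b refl = s≤s z≤n

  count-remove : ∀ {k} (f : Fin (suc k) → Bool) i → f i ≡ true → count f ≡ suc (count (λ j → f (punchIn i j)))
  count-remove f i fi = begin
    count f                                  ≡⟨ natSum≗sum (λ j → ind (f j)) ⟩
    sum (λ j → ind (f j))                    ≡⟨ sum-remove (λ j → ind (f j)) ⟩
    ind (f i) + sum (λ j → ind (f (punchIn i j)))  ≡⟨ cong₂ _+_ (cong ind fi) (sym (natSum≗sum (λ j → ind (f (punchIn i j))))) ⟩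
    suc (count (λ j → f (punchIn i j)))      ∎
    where open ≡-Reasoning

  survives-removal : ∀ {k} (f : Fin (suc k) → Bool) {i j} (i≢j : i ≢ j) →
    f j ≡ true → f (punchIn i (punchOut i≢j)) ≡ true
  survives-removal f i≢j fj = subst (λ x → f x ≡ true) (sym (punchIn-punchOut i≢j)) fj

  count-≥1 : ∀ {k} (f : Fin k → Bool) {i} → f i ≡ true → 1 ≤ count f
  count-≥1 {suc k} f {i} fi rewrite count-remove f i fi = s≤s z≤n

  count-≥2 : ∀ {k} (f : Fin k → Bool) {i j} → i ≢ j → f i ≡ true → f j ≡ true → 2 ≤ count f
  count-≥2 {suc k} f {i} i≢j fi fj rewrite count-remove f i fi =
    s≤s (count-≥1 (λ x → f (punchIn i x)) (survives-removal f i≢j fj))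

  count-≥3 : ∀ {k} (f : Fin k → Bool) {i j l} → i ≢ j → i ≢ l → j ≢ l →
    f i ≡ true → f j ≡ true → f l ≡ true → 3 ≤ count f
  count-≥3 {suc k} f {i} i≢j i≢l j≢l fi fj fl rewrite count-remove f i fi =
    s≤s (count-≥2 (λ x → f (punchIn i x)) (λ eq → j≢l (punchOut-injective i≢j i≢l eq))
                  (survives-removal f i≢j fj) (survives-removal f i≢l fl))

  count-witness : ∀ {k} (f : Fin k → Bool) → 1 ≤ count f → ∃ λ i → f i ≡ true
  count-witness {suc k} f 1≤count with f zero in f0
  ... | true  = zero , f0
  ... | false with count-witness (λ i → f (suc i)) 1≤count
  ...   | i , fi = suc i , fi

  count-two-witnesses : ∀ {k} (f : Fin k → Bool) → count f ≡ 2 →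
    ∃ λ i → ∃ λ j → i ≢ j × f i ≡ true × f j ≡ true
  count-two-witnesses {suc k} f count≡2 with count-witness f (subst (1 ≤_) (sym count≡2) (s≤s z≤n))
  ... | i , fi with count-witness (λ x → f (punchIn i x))
                      (subst (1 ≤_) (sym (suc-injective (trans (sym (count-remove f i fi)) count≡2))) (s≤s z≤n))
  ...   | j , fj = i , punchIn i j , (λ i≡ → punchInᵢ≢i i j (sym i≡)) , fi , fj

  count-two-only : ∀ {k} (f : Fin k → Bool) → count f ≡ 2 → ∀ {i j} → i ≢ j → f i ≡ true → f j ≡ true →
    ∀ l → l ≢ i → l ≢ j → f l ≡ false
  count-two-only f count≡2 i≢j fi fj l l≢i l≢j with f l in fl
  ... | false = refl
  ... | true  with s≤s (s≤s ()) ← subst (3 ≤_) count≡2 (count-≥3 f i≢j (λ i≡l → l≢i (sym i≡l)) (λ j≡l → l≢j (sym j≡l)) fi fj fl)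

module Matrix where
  open GF2Sum
  open import Relation.Binary.Bundles using (Setoid)

  Mat : ℕ → ℕ → Set
  Mat p q = Fin p → Fin q → Bool

  infix 4 _≐_
  _≐_ : ∀ {p q} → Mat p q → Mat p q → Set
  A ≐ B = ∀ i j → A i j ≡ B i j

  infixl 6 _⊕_
  _⊕_ : ∀ {p q} → Mat p q → Mat p q → Mat p q
  (A ⊕ B) i j = A i j xor B i j

  O : ∀ {p q} → Mat p q
  O i j = false

  ≐-setoid : ℕ → ℕ → Setoid 0ℓ 0ℓ
  ≐-setoid p q = record
    { Carrier       = Mat p q
    ; _≈_           = _≐_
    ; isEquivalence = record
      { refl  = λ i j → refl
      ; sym   = λ A≐B i j → sym (A≐B i j)
      ; trans = λ A≐B B≐C i j → trans (A≐B i j) (B≐C i j) } }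

  ⊕-cong : ∀ {p q} {A A' B B' : Mat p q} → A ≐ A' → B ≐ B' → A ⊕ B ≐ A' ⊕ B'
  ⊕-cong A≐A' B≐B' i j = cong₂ _xor_ (A≐A' i j) (B≐B' i j)

  ⊕-congˡ : ∀ {p q} (A : Mat p q) {B B' : Mat p q} → B ≐ B' → A ⊕ B ≐ A ⊕ B'
  ⊕-congˡ A = ⊕-cong {A = A} (λ i j → refl)

  ⊕-congʳ : ∀ {p q} (B : Mat p q) {A A' : Mat p q} → A ≐ A' → A ⊕ B ≐ A' ⊕ B
  ⊕-congʳ B A≐A' = ⊕-cong A≐A' (λ i j → refl)

  ⊕-self : ∀ {p q} (A : Mat p q) → A ⊕ A ≐ O
  ⊕-self A i j = xor-same (A i j)

  ⊕-identityʳ : ∀ {p q} (A : Mat p q) → A ⊕ O ≐ A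
  ⊕-identityʳ A i j = xor-identityʳ (A i j)

  -- in characteristic 2 a repeated middle summand cancels
  ⊕-cancel-middle : ∀ {p q} (A B C : Mat p q) → (A ⊕ B) ⊕ (B ⊕ C) ≐ A ⊕ C
  ⊕-cancel-middle A B C i j = begin
    (a xor b) xor (b xor c) ≡⟨ xor-assoc a b (b xor c) ⟩
    a xor (b xor (b xor c)) ≡⟨ cong (a xor_) (sym (xor-assoc b b c)) ⟩
    a xor ((b xor b) xor c) ≡⟨ cong (λ x → a xor (x xor c)) (xor-same b) ⟩
    a xor c                 ∎
    where
    open ≡-Reasoning
    a = A i j
    b = B i j
    c = C i j

  ⊛-cong : ∀ {p q r} {A A' : Mat p q} {B B' : Mat q r} → A ≐ A' → B ≐ B' → A ⊛ B ≐ A' ⊛ B'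
  ⊛-cong A≐A' B≐B' i k = xorSum-cong (λ j → cong₂ _∧_ (A≐A' i j) (B≐B' j k))

  ⊛-congˡ : ∀ {p q r} (A : Mat p q) {B B' : Mat q r} → B ≐ B' → A ⊛ B ≐ A ⊛ B'
  ⊛-congˡ A = ⊛-cong {A = A} (λ i j → refl)

  ⊛-congʳ : ∀ {p q r} {A A' : Mat p q} (B : Mat q r) → A ≐ A' → A ⊛ B ≐ A' ⊛ B
  ⊛-congʳ B A≐A' = ⊛-cong A≐A' (λ i j → refl)

  ⊛-assoc : ∀ {p q r s} (A : Mat p q) (B : Mat q r) (C : Mat r s) → (A ⊛ B) ⊛ C ≐ A ⊛ (B ⊛ C)
  ⊛-assoc A B C i k = begin
    xorSum (λ l → xorSum (λ j → A i j ∧ B j l) ∧ C l k)   ≡⟨ xorSum-cong (λ l → sym (xorSum-∧ʳ (C l k) (λ j → A i j ∧ B j l))) ⟩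
    xorSum (λ l → xorSum (λ j → (A i j ∧ B j l) ∧ C l k)) ≡⟨ xorSum-swap (λ l j → (A i j ∧ B j l) ∧ C l k) ⟩
    xorSum (λ j → xorSum (λ l → (A i j ∧ B j l) ∧ C l k)) ≡⟨ xorSum-cong (λ j → xorSum-cong (λ l → ∧-assoc (A i j) (B j l) (C l k))) ⟩
    xorSum (λ j → xorSum (λ l → A i j ∧ (B j l ∧ C l k))) ≡⟨ xorSum-cong (λ j → xorSum-∧ˡ (A i j) (λ l → B j l ∧ C l k)) ⟩
    xorSum (λ j → A i j ∧ xorSum (λ l → B j l ∧ C l k))   ∎
    where open ≡-Reasoning

  ⊛-distribˡ : ∀ {p q r} (A : Mat p q) (B C : Mat q r) → A ⊛ (B ⊕ C) ≐ A ⊛ B ⊕ A ⊛ C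
  ⊛-distribˡ A B C i k =
    trans (xorSum-cong (λ j → ∧-distribˡ-xor (A i j) (B j k) (C j k)))
          (xorSum-xor (λ j → A i j ∧ B j k) (λ j → A i j ∧ C j k))

  ⊛-distribʳ : ∀ {p q r} (A B : Mat p q) (C : Mat q r) → (A ⊕ B) ⊛ C ≐ A ⊛ C ⊕ B ⊛ C
  ⊛-distribʳ A B C i k =
    trans (xorSum-cong (λ j → ∧-distribʳ-xor (C j k) (A i j) (B i j)))
          (xorSum-xor (λ j → A i j ∧ C j k) (λ j → B i j ∧ C j k))

  δ-⊛ : ∀ {p q} (A : Mat p q) → δ ⊛ A ≐ A
  δ-⊛ A i k = xorSum-δ i (λ j → A j k)

  ⊛-δ : ∀ {p q} (A : Mat p q) → A ⊛ δ ≐ A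
  ⊛-δ A i k = trans (xorSum-cong (λ j → trans (∧-comm (A i j) (δ j k)) (cong (_∧ A i j) (δ-sym j k)))) (xorSum-δ k (A i))

  ⊛-O : ∀ {p q r} (A : Mat p q) → A ⊛ O {q} {r} ≐ O
  ⊛-O A i k = xorSum-false _ (λ j → ∧-zeroʳ (A i j))

  O-⊛ : ∀ {p q r} (A : Mat q r) → O {p} {q} ⊛ A ≐ O
  O-⊛ {q = q} A i k = xorSum-false {q} _ (λ j → refl)

-- Neumann series over GF(2): for any square N, the partial geometric sums
-- geo k = I + N + … + N^(k-1) satisfy (I + N)·geo k = I + N^k = geo k·(I + N);
-- hence I + N is invertible with inverse geo T as soon as N^T = 0.
module Neumann {p} (N : Matrix.Mat p p) where
  open Matrix
  open import Relation.Binary.Reasoning.Setoid (≐-setoid p p)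

  pow : ℕ → Mat p p
  pow zero    = δ
  pow (suc k) = N ⊛ pow k

  geo : ℕ → Mat p p
  geo zero    = O
  geo (suc k) = δ ⊕ N ⊛ geo k

  commute : (X : Mat p p) → (δ ⊕ N) ⊛ (N ⊛ X) ≐ N ⊛ ((δ ⊕ N) ⊛ X)
  commute X = begin
    (δ ⊕ N) ⊛ (N ⊛ X)              ≈⟨ ⊛-distribʳ δ N (N ⊛ X) ⟩
    δ ⊛ (N ⊛ X) ⊕ N ⊛ (N ⊛ X)      ≈⟨ ⊕-congʳ (N ⊛ (N ⊛ X)) (δ-⊛ (N ⊛ X)) ⟩
    N ⊛ X ⊕ N ⊛ (N ⊛ X)            ≈⟨ ⊕-congʳ (N ⊛ (N ⊛ X)) (⊛-congˡ N (δ-⊛ X)) ⟨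
    N ⊛ (δ ⊛ X) ⊕ N ⊛ (N ⊛ X)      ≈⟨ ⊛-distribˡ N (δ ⊛ X) (N ⊛ X) ⟨
    N ⊛ (δ ⊛ X ⊕ N ⊛ X)            ≈⟨ ⊛-congˡ N (⊛-distribʳ δ N X) ⟨
    N ⊛ ((δ ⊕ N) ⊛ X)              ∎

  telescope : ∀ k → (δ ⊕ N) ⊕ N ⊛ (δ ⊕ pow k) ≐ δ ⊕ pow (suc k)
  telescope k = begin
    (δ ⊕ N) ⊕ N ⊛ (δ ⊕ pow k)        ≈⟨ ⊕-congˡ (δ ⊕ N) (⊛-distribˡ N δ (pow k)) ⟩
    (δ ⊕ N) ⊕ (N ⊛ δ ⊕ pow (suc k))  ≈⟨ ⊕-congˡ (δ ⊕ N) (⊕-congʳ (pow (suc k)) (⊛-δ N)) ⟩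
    (δ ⊕ N) ⊕ (N ⊕ pow (suc k))      ≈⟨ ⊕-cancel-middle δ N (pow (suc k)) ⟩
    δ ⊕ pow (suc k)                  ∎

  geo-left : ∀ k → (δ ⊕ N) ⊛ geo k ≐ δ ⊕ pow k
  geo-left zero = begin
    (δ ⊕ N) ⊛ O ≈⟨ ⊛-O (δ ⊕ N) ⟩
    O           ≈⟨ ⊕-self δ ⟨
    δ ⊕ δ       ∎
  geo-left (suc k) = begin
    (δ ⊕ N) ⊛ (δ ⊕ N ⊛ geo k)                ≈⟨ ⊛-distribˡ (δ ⊕ N) δ (N ⊛ geo k) ⟩
    (δ ⊕ N) ⊛ δ ⊕ (δ ⊕ N) ⊛ (N ⊛ geo k)      ≈⟨ ⊕-cong (⊛-δ (δ ⊕ N)) (commute (geo k)) ⟩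
    (δ ⊕ N) ⊕ N ⊛ ((δ ⊕ N) ⊛ geo k)          ≈⟨ ⊕-congˡ (δ ⊕ N) (⊛-congˡ N (geo-left k)) ⟩
    (δ ⊕ N) ⊕ N ⊛ (δ ⊕ pow k)                ≈⟨ telescope k ⟩
    δ ⊕ pow (suc k)                          ∎

  geo-right : ∀ k → geo k ⊛ (δ ⊕ N) ≐ δ ⊕ pow k
  geo-right zero = begin
    O ⊛ (δ ⊕ N) ≈⟨ O-⊛ (δ ⊕ N) ⟩
    O           ≈⟨ ⊕-self δ ⟨
    δ ⊕ δ       ∎
  geo-right (suc k) = begin
    (δ ⊕ N ⊛ geo k) ⊛ (δ ⊕ N)                ≈⟨ ⊛-distribʳ δ (N ⊛ geo k) (δ ⊕ N) ⟩
    δ ⊛ (δ ⊕ N) ⊕ (N ⊛ geo k) ⊛ (δ ⊕ N)      ≈⟨ ⊕-cong (δ-⊛ (δ ⊕ N)) (⊛-assoc N (geo k) (δ ⊕ N)) ⟩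
    (δ ⊕ N) ⊕ N ⊛ (geo k ⊛ (δ ⊕ N))          ≈⟨ ⊕-congˡ (δ ⊕ N) (⊛-congˡ N (geo-right k)) ⟩
    (δ ⊕ N) ⊕ N ⊛ (δ ⊕ pow k)                ≈⟨ telescope k ⟩
    δ ⊕ pow (suc k)                          ∎

  nilpotent-inverse : ∀ T → pow T ≐ O → ((δ ⊕ N) ⊛ geo T ≐ δ) × (geo T ⊛ (δ ⊕ N) ≐ δ)
  nilpotent-inverse T powT≐O = (begin
      (δ ⊕ N) ⊛ geo T ≈⟨ geo-left T ⟩
      δ ⊕ pow T       ≈⟨ ⊕-congˡ δ powT≐O ⟩
      δ ⊕ O           ≈⟨ ⊕-identityʳ δ ⟩
      δ               ∎)
    , (begin
      geo T ⊛ (δ ⊕ N) ≈⟨ geo-right T ⟩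
      δ ⊕ pow T       ≈⟨ ⊕-congˡ δ powT≐O ⟩
      δ ⊕ O           ≈⟨ ⊕-identityʳ δ ⟩
      δ               ∎)

module Triangular {p} (N : Matrix.Mat p p) (rank : Fin p → ℕ)
                  (increasing : ∀ a b → N a b ≡ true → rank a < rank b) where
  open Matrix
  open Neumann N using (pow)
  open GF2Sum using (xorSum-true)

  pow-climbs : ∀ k a b → pow k a b ≡ true → rank a + k ≤ rank b
  pow-climbs zero a b δab rewrite δ-true δab | +-identityʳ (rank b) = ≤-refl
  pow-climbs (suc k) a b powab with xorSum-true (λ c → N a c ∧ pow k c b) powab
  ... | c , Nac∧powcb with ∧-true Nac∧powcb
  ...   | Nac , powcb = begin
    rank a + suc k   ≡⟨ +-suc (rank a) k ⟩
    suc (rank a) + k ≤⟨ +-monoˡ-≤ k (increasing a c Nac) ⟩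
    rank c + k       ≤⟨ pow-climbs k c b powcb ⟩
    rank b           ∎
    where open ≤-Reasoning

  nilpotent : ∀ T → (∀ a → rank a < T) → pow T ≐ O
  nilpotent T rank<T a b with pow T a b in powab
  ... | false = refl
  ... | true  = ⊥-elim (<-irrefl refl (≤-<-trans (≤-trans (m≤n+m T (rank a)) (pow-climbs T a b powab)) (rank<T b)))

module Balls {p q} (Q : Matrix.Mat p q) where
  open FactorGraph Q using (ball)

  ball-centre : ∀ v t → ball v t v ≡ true
  ball-centre v zero    = δ-refl v
  ball-centre v (suc t) rewrite ball-centre v t = refl

  ball-step : ∀ v t {w w'} a → ball v t w ≡ true → Q a w ≡ true → Q a w' ≡ true → ball v (suc t) w' ≡ true
  ball-step v t {w} {w'} a w∈B Qaw Qaw' =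
    trans (cong (ball v t w' ∨_) (anyFin-intro _ a (cong₂ _∧_ Qaw' (anyFin-intro _ w (cong₂ _∧_ w∈B Qaw)))))
          (∨-zeroʳ (ball v t w'))

-- Columns u of Q carrying a one on the diagonal (Q a (u a) = 1): then
-- Q_{F,u} = I + N with N its off-diagonal part, and the entries of the
-- partial Neumann sums times Q stay local: (geo j · Q)_{b,w} ≠ 0 only when
-- u_b lies within distance j of w.
module DiagonalColumns {p q} (Q : Matrix.Mat p q) (u : Fin p → Fin q)
                       (Q-diagonal : ∀ a → Q a (u a) ≡ true) where
  open Matrix
  open FactorGraph Q using (ball)
  open Balls Q
  open GF2Sum using (xorSum-true)

  offDiag : Mat p p
  offDiag a b = Q a (u b) ∧ not (δ a b)

  open Neumann offDiag using (geo)

  Qu-split : (λ a b → Q a (u b)) ≐ δ ⊕ offDiag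
  Qu-split a b with a ≟ b
  ... | yes refl rewrite Q-diagonal a = refl
  ... | no  _    = sym (∧-identityʳ (Q a (u b)))

  geo-suc-⊛ : ∀ j → geo (suc j) ⊛ Q ≐ Q ⊕ offDiag ⊛ (geo j ⊛ Q)
  geo-suc-⊛ j = begin
    (δ ⊕ offDiag ⊛ geo j) ⊛ Q             ≈⟨ ⊛-distribʳ δ (offDiag ⊛ geo j) Q ⟩
    δ ⊛ Q ⊕ (offDiag ⊛ geo j) ⊛ Q         ≈⟨ ⊕-cong (δ-⊛ Q) (⊛-assoc offDiag (geo j) Q) ⟩
    Q ⊕ offDiag ⊛ (geo j ⊛ Q)             ∎
    where open import Relation.Binary.Reasoning.Setoid (≐-setoid p q)

  -- by induction on j, one check-hop per factor N
  geo-local : ∀ j b w → (geo j ⊛ Q) b w ≡ true → ball w j (u b) ≡ true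
  geo-local zero b w O⊛Q≡1 with () ← trans (sym O⊛Q≡1) (O-⊛ Q b w)
  geo-local (suc j) b w geo⊛Q≡1 with xor-true (trans (sym (geo-suc-⊛ j b w)) geo⊛Q≡1)
  ... | inj₁ Qbw = ball-step w j b (ball-centre w j) Qbw (Q-diagonal b)
  ... | inj₂ N⊛geo⊛Q≡1 with xorSum-true (λ c → offDiag b c ∧ (geo j ⊛ Q) c w) N⊛geo⊛Q≡1
  ...   | c , Nbc∧geoQcw with ∧-true Nbc∧geoQcw
  ...     | Nbc , geoQcw = ball-step w j b (geo-local j c w geoQcw) (proj₁ (∧-true Nbc)) (Q-diagonal b)

-- Given an admissible choice a ↦ u_a
-- (u_a a leaf of a in round r_a), every other check b adjacent to u_a was
-- already peeled strictly before round r_a.  Hence Q restricted to the columns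
-- u is I + N with N strictly triangular for the rounds, and is invertible.
module PeelingOrder {p q} (Q : Matrix.Mat p q) {T : ℕ} {u : Fin p → Fin q}
                    (valid : FactorGraph.ValidChoice Q T u) where
  open Matrix
  open FactorGraph Q
  open NatSum using (count-≥2)

  round : Fin p → ℕ
  round a = proj₁ (valid a)

  round<T : ∀ a → round a < T
  round<T a = proj₁ (proj₂ (valid a))

  Q-diagonal : ∀ a → Q a (u a) ≡ true
  Q-diagonal a = proj₁ (proj₂ (proj₂ (proj₂ (proj₂ (valid a)))))

  alive-at-round : ∀ a → aliveC (J (round a)) a ≡ true
  alive-at-round a = proj₁ (∧-true (proj₁ (proj₂ (proj₂ (valid a)))))

  leaf-degree : ∀ a → vdeg (J (round a)) (u a) ≡ 1
  leaf-degree a = proj₂ (proj₂ (proj₂ (proj₂ (proj₂ (valid a)))))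

  alive-earlier : ∀ {s s'} a → s ≤′ s' → aliveC (J s') a ≡ true → aliveC (J s) a ≡ true
  alive-earlier a ≤′-refl        alive = alive
  alive-earlier a (≤′-step s≤s') alive = alive-earlier a s≤s' (proj₁ (∧-true alive))

  -- u_b has degree one when b is peeled, so no other neighbour a is still alive then
  earlier : ∀ a b → Q a (u b) ≡ true → a ≢ b → round a < round b
  earlier a b Qaub a≢b with round b ≤? round a
  ... | no  rb≰ra = ≰⇒> rb≰ra
  ... | yes rb≤ra = ⊥-elim (2≰1 (subst (2 ≤_) (leaf-degree b) (count-≥2 _ a≢b a-alive b-alive)))
    where
    2≰1 : ¬ (2 ≤ 1)
    2≰1 (s≤s ())
    a-alive : aliveC (J (round b)) a ∧ Q a (u b) ≡ true
    a-alive = cong₂ _∧_ (alive-earlier a (≤⇒≤′ rb≤ra) (alive-at-round a)) Qaub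
    b-alive : aliveC (J (round b)) b ∧ Q b (u b) ≡ true
    b-alive = cong₂ _∧_ (alive-at-round b) (Q-diagonal b)

  open DiagonalColumns Q u Q-diagonal public
  open Neumann offDiag using (geo; nilpotent-inverse)

  offDiag-increasing : ∀ a b → offDiag a b ≡ true → round a < round b
  offDiag-increasing a b off with ∧-true off
  ... | Qaub , ¬δab = earlier a b Qaub (not-δ⇒≢ ¬δab)

  open Triangular offDiag round offDiag-increasing using (nilpotent)

  Qu-inverse : ((λ a b → Q a (u b)) ⊛ geo T ≐ δ) × (geo T ⊛ (λ a b → Q a (u b)) ≐ δ)
  Qu-inverse with nilpotent-inverse T (nilpotent T round<T)
  ... | left , right =
    (λ a b → trans (⊛-congʳ (geo T) Qu-split a b) (left a b)) ,
    (λ a b → trans (⊛-congˡ (geo T) Qu-split a b) (right a b))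

-- Suppose the
-- columns u : F → V of Q form an invertible square block Q_u with inverse M.
-- With W the remaining columns, the vectors
--     column w = e_w + Σ_b e_{u b} (M Q)_{b,w}        (w ∈ W)
-- are the columns of [M Q_W ; I] (rows U then W) and form a basis of ker Q:
-- they lie in ker Q, restricted to W they are the unit vectors, and a kernel
-- vector vanishing on W vanishes (it is determined by its U-part via Q_u).
module SystematicBasis {p q} (Q : Matrix.Mat p q) (u : Fin p → Fin q) (M : Matrix.Mat p p)
    (right-inverse : ∀ a b → ((λ a b → Q a (u b)) ⊛ M) a b ≡ δ a b)
    (left-inverse  : ∀ a b → (M ⊛ (λ a b → Q a (u b))) a b ≡ δ a b) where
  open Matrix
  open GF2Sum

  Qu : Mat p p
  Qu a b = Q a (u b)

  u-injective : ∀ {a b} → u a ≡ u b → a ≡ b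
  u-injective {a} {b} ua≡ub = δ-true (begin
    δ a b         ≡⟨ left-inverse a b ⟨
    (M ⊛ Qu) a b  ≡⟨ xorSum-cong (λ c → cong (λ v → M a c ∧ Q c v) ua≡ub) ⟨
    (M ⊛ Qu) a a  ≡⟨ left-inverse a a ⟩
    δ a a         ≡⟨ δ-refl a ⟩
    true          ∎)
    where open ≡-Reasoning

  inU : Fin q → Bool
  inU v = anyFin (λ a → ⌊ u a ≟ v ⌋)

  inW : Fin q → Bool
  inW v = not (inU v)

  in-U-or-W : ∀ v → (∃ λ a → u a ≡ v) ⊎ inW v ≡ true
  in-U-or-W v with inU v in inUv
  ... | false = inj₂ refl
  ... | true  with anyFin-witness (λ a → δ (u a) v) inUv
  ...   | a , δuav = inj₁ (a , δ-true δuav)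

  W-avoids-u : ∀ {v} → inW v ≡ true → ∀ a → δ (u a) v ≡ false
  W-avoids-u {v} v∈W = anyFin-none (λ a → δ (u a) v) (not-injective v∈W)
    where
    not-injective : ∀ {x} → not x ≡ true → x ≡ false
    not-injective {false} _ = refl

  -- place the rows of G (indexed by F) at the rows u of a V-indexed matrix
  lift : ∀ {r} → Mat p r → Mat q r
  lift G v k = xorSum (λ c → δ (u c) v ∧ G c k)

  lift-at-u : ∀ {r} (G : Mat p r) a k → lift G (u a) k ≡ G a k
  lift-at-u G a k = trans (xorSum-single _ a off-a) (cong (_∧ G a k) (δ-refl (u a)))
    where
    off-a : ∀ c → c ≢ a → δ (u c) (u a) ∧ G c k ≡ false
    off-a c c≢a = cong (_∧ G c k) (δ-≢ (λ uc≡ua → c≢a (u-injective uc≡ua)))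

  lift-on-W : ∀ {r} (G : Mat p r) {v} → inW v ≡ true → ∀ k → lift G v k ≡ false
  lift-on-W G v∈W k = xorSum-false _ (λ c → cong (_∧ G c k) (W-avoids-u v∈W c))

  Q-lift : ∀ {r} (G : Mat p r) → Q ⊛ lift G ≐ Qu ⊛ G
  Q-lift G b k = begin
    xorSum (λ v → Q b v ∧ xorSum (λ c → δ (u c) v ∧ G c k))   ≡⟨ xorSum-cong (λ v → sym (xorSum-∧ˡ (Q b v) (λ c → δ (u c) v ∧ G c k))) ⟩
    xorSum (λ v → xorSum (λ c → Q b v ∧ (δ (u c) v ∧ G c k))) ≡⟨ xorSum-swap (λ v c → Q b v ∧ (δ (u c) v ∧ G c k)) ⟩
    xorSum (λ c → xorSum (λ v → Q b v ∧ (δ (u c) v ∧ G c k))) ≡⟨ xorSum-cong (λ c → xorSum-cong (λ v → ∧-left-comm (Q b v) (δ (u c) v) (G c k))) ⟩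
    xorSum (λ c → xorSum (λ v → δ (u c) v ∧ (Q b v ∧ G c k))) ≡⟨ xorSum-cong (λ c → xorSum-δ (u c) (λ v → Q b v ∧ G c k)) ⟩
    xorSum (λ c → Q b (u c) ∧ G c k)                           ∎
    where open ≡-Reasoning

  column : Fin q → Fin q → Bool
  column w v = δ w v xor lift (M ⊛ Q) v w

  columns : Mat q q
  columns v w = column w v

  columns-split : columns ≐ δ ⊕ lift (M ⊛ Q)
  columns-split v w = cong (_xor lift (M ⊛ Q) v w) (δ-sym w v)

  Q-columns : Q ⊛ columns ≐ O
  Q-columns = begin
    Q ⊛ columns                 ≈⟨ ⊛-congˡ Q columns-split ⟩
    Q ⊛ (δ ⊕ lift (M ⊛ Q))      ≈⟨ ⊛-distribˡ Q δ (lift (M ⊛ Q)) ⟩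
    Q ⊛ δ ⊕ Q ⊛ lift (M ⊛ Q)    ≈⟨ ⊕-cong (⊛-δ Q) (Q-lift (M ⊛ Q)) ⟩
    Q ⊕ Qu ⊛ (M ⊛ Q)            ≈⟨ ⊕-congˡ Q (⊛-assoc Qu M Q) ⟨
    Q ⊕ (Qu ⊛ M) ⊛ Q            ≈⟨ ⊕-congˡ Q (⊛-congʳ Q right-inverse) ⟩
    Q ⊕ δ ⊛ Q                   ≈⟨ ⊕-congˡ Q (δ-⊛ Q) ⟩
    Q ⊕ Q                       ≈⟨ ⊕-self Q ⟩
    O                           ∎
    where open import Relation.Binary.Reasoning.Setoid (≐-setoid p q)

  column-kernel : ∀ w → InKer Q (column w)
  column-kernel w b = Q-columns b w

  column-on-W : ∀ w {v} → inW v ≡ true → column w v ≡ δ w v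
  column-on-W w v∈W = trans (cong (δ w _ xor_) (lift-on-W (M ⊛ Q) v∈W w)) (xor-identityʳ _)

  combination : (Fin q → Bool) → Fin q → Bool
  combination c v = xorSum (λ w → inW w ∧ c w ∧ column w v)

  combination-on-W : ∀ c {v} → inW v ≡ true → combination c v ≡ c v
  combination-on-W c {v} v∈W = trans (xorSum-single _ v off-v) (begin
    inW v ∧ c v ∧ column v v  ≡⟨ cong₂ (λ x y → x ∧ c v ∧ y) v∈W (trans (column-on-W v v∈W) (δ-refl v)) ⟩
    c v ∧ true                ≡⟨ ∧-identityʳ (c v) ⟩
    c v                       ∎)
    where
    open ≡-Reasoning
    off-v : ∀ w → w ≢ v → inW w ∧ c w ∧ column w v ≡ false
    off-v w w≢v rewrite column-on-W w v∈W | δ-≢ w≢v | ∧-zeroʳ (c w) = ∧-zeroʳ (inW w)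

  combination-kernel : ∀ c → InKer Q (combination c)
  combination-kernel c b = begin
    (Q ⊛ Comb) b zero                ≡⟨ ⊛-congˡ Q as-product b zero ⟩
    (Q ⊛ (columns ⊛ weights)) b zero ≡⟨ ⊛-assoc Q columns weights b zero ⟨
    ((Q ⊛ columns) ⊛ weights) b zero ≡⟨ ⊛-congʳ weights Q-columns b zero ⟩
    (O ⊛ weights) b zero             ≡⟨ O-⊛ weights b zero ⟩
    false                            ∎
    where
    open ≡-Reasoning
    Comb : Mat q 1
    Comb v _ = combination c v
    weights : Mat q 1
    weights w _ = inW w ∧ c w
    as-product : Comb ≐ columns ⊛ weights
    as-product v _ = xorSum-cong (λ w → ∧-rotate (inW w) (c w) (column w v))

  kernel-vanishing : ∀ e → InKer Q e → (∀ w → inW w ≡ true → e w ≡ false) → ∀ v → e v ≡ false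
  kernel-vanishing e e∈ker e|W≡0 v with in-U-or-W v
  ... | inj₂ v∈W        = e|W≡0 v v∈W
  ... | inj₁ (a , refl) = E≐O a zero
    where
    E : Mat p 1
    E c _ = e (u c)
    e≐liftE : ∀ v → e v ≡ lift E v zero
    e≐liftE v with in-U-or-W v
    ... | inj₁ (c , refl) = sym (lift-at-u E c zero)
    ... | inj₂ v∈W        = trans (e|W≡0 v v∈W) (sym (lift-on-W E v∈W zero))
    QuE≐O : Qu ⊛ E ≐ O
    QuE≐O b k = trans (sym (Q-lift E b k)) (trans (xorSum-cong (λ v → cong (Q b v ∧_) (sym (e≐liftE v)))) (e∈ker b))
    E≐O : E ≐ O
    E≐O = begin
      E              ≈⟨ δ-⊛ E ⟨
      δ ⊛ E          ≈⟨ ⊛-congʳ E left-inverse ⟨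
      (M ⊛ Qu) ⊛ E   ≈⟨ ⊛-assoc M Qu E ⟩
      M ⊛ (Qu ⊛ E)   ≈⟨ ⊛-congˡ M QuE≐O ⟩
      M ⊛ O          ≈⟨ ⊛-O M ⟩
      O              ∎
      where open import Relation.Binary.Reasoning.Setoid (≐-setoid p 1)

  kernel-spanned : ∀ e → InKer Q e → ∀ v → e v ≡ combination e v
  kernel-spanned e e∈ker v = xor-false⇒≡ (kernel-vanishing d d∈ker d|W≡0 v)
    where
    d : Fin q → Bool
    d v = e v xor combination e v
    d∈ker : InKer Q d
    d∈ker b = trans (xorSum-cong (λ v → ∧-distribˡ-xor (Q b v) (e v) _))
                    (trans (xorSum-xor (λ v → Q b v ∧ e v) (λ v → Q b v ∧ combination e v)) (cong₂ _xor_ (e∈ker b) (combination-kernel e b)))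
    d|W≡0 : ∀ w → inW w ≡ true → d w ≡ false
    d|W≡0 w w∈W = trans (cong (e w xor_) (combination-on-W e w∈W)) (xor-same (e w))

module PeeledBasis {p q} (Q : Matrix.Mat p q) {T : ℕ} {u : Fin p → Fin q}
                   (valid : FactorGraph.ValidChoice Q T u) where
  open FactorGraph Q using (ball)
  open PeelingOrder Q valid public
  open Neumann offDiag using (geo)
  open SystematicBasis Q u (geo T) (proj₁ Qu-inverse) (proj₂ Qu-inverse) public
  open Balls Q using (ball-centre)
  open GF2Sum using (xorSum-true)

  column-local : ∀ w v → column w v ≡ true → ball w T v ≡ true
  column-local w v col≡1 with xor-true col≡1
  ... | inj₁ δwv = subst (λ x → ball w T x ≡ true) (δ-true δwv) (ball-centre w T)
  ... | inj₂ lift≡1 with xorSum-true (λ c → δ (u c) v ∧ (geo T ⊛ Q) c w) lift≡1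
  ...   | c , δucv∧geoQ with ∧-true δucv∧geoQ
  ...     | δucv , geoQcw = subst (λ x → ball w T x ≡ true) (δ-true δucv) (geo-local T c w geoQcw)

-- Writing 𝕃 z for the spreading of a super-node vector
-- z to the variables (i ↦ z (comp i)): the checks of degree ≥ 3 act on 𝕃 z as
-- Q acts on z, and a check of degree 2 forces equal values on its two
-- neighbours, which lie in one super-node.  Hence ker H = 𝕃 (ker Q).
module Collapse {m n} (H : Matrix.Mat m n) (deg≥2 : ∀ a → 2 ≤ checkDeg H a) (C : Collapsed H) where
  open Matrix
  open Lemma H C
  open GF2Sum
  open NatSum

  expand : (Fin nS → Bool) → Fin n → Bool
  expand z i = xorSum (λ v → L i v ∧ z v)

  expand-comp : ∀ z i → expand z i ≡ z (comp i)
  expand-comp z i = xorSum-δ (comp i) z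

  -- Q = H_{F_*} 𝕃, so the check fS b tests 𝕃 z exactly as the row b of Q tests z
  H-collapses-to-Q : ∀ b z → xorSum (λ i → H (fS b) i ∧ z (comp i)) ≡ xorSum (λ v → Q b v ∧ z v)
  H-collapses-to-Q b z = begin
    xorSum (λ i → H (fS b) i ∧ z (comp i)) ≡⟨ xorSum-cong (λ i → cong (H (fS b) i ∧_) (sym (expand-comp z i))) ⟩
    (H* ⊛ (L ⊛ Z)) b zero                  ≡⟨ ⊛-assoc H* L Z b zero ⟨
    ((H* ⊛ L) ⊛ Z) b zero                  ∎
    where
    open ≡-Reasoning
    H* : Mat mS n
    H* b i = H (fS b) i
    Z : Mat nS 1
    Z v _ = z v

  degree-two-sum : ∀ {a i j} → checkDeg H a ≡ 2 → i ≢ j → H a i ≡ true → H a j ≡ true →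
    ∀ (y : Fin n → Bool) → xorSum (λ l → H a l ∧ y l) ≡ y i xor y j
  degree-two-sum {a} {i} {j} deg≡2 i≢j Hai Haj y =
    trans (xorSum-pair (λ l → H a l ∧ y l) i≢j
             (λ l l≢i l≢j → cong (_∧ y l) (count-two-only (H a) deg≡2 i≢j Hai Haj l l≢i l≢j)))
          (cong₂ (λ x x' → (x ∧ y i) xor (x' ∧ y j)) Hai Haj)

  degree-two : ∀ {a} → ¬ (3 ≤ checkDeg H a) → checkDeg H a ≡ 2
  degree-two {a} 3≰deg = ≤-antisym (≤-pred (≰⇒> 3≰deg)) (deg≥2 a)

  pullback-kernel : ∀ z → InKer Q z → InKer H (expand z)
  pullback-kernel z z∈ker a = trans (xorSum-cong (λ i → cong (H a i ∧_) (expand-comp z i))) by-degree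
    where
    by-degree : xorSum (λ i → H a i ∧ z (comp i)) ≡ false
    by-degree with 3 ≤? checkDeg H a
    ... | yes 3≤deg with fS-all a 3≤deg
    ...   | b , refl = trans (H-collapses-to-Q b z) (z∈ker b)
    by-degree | no 3≰deg with count-two-witnesses (H a) (degree-two 3≰deg)
    ... | i , j , i≢j , Hai , Haj = begin
      xorSum (λ l → H a l ∧ z (comp l)) ≡⟨ degree-two-sum (degree-two 3≰deg) i≢j Hai Haj (λ l → z (comp l)) ⟩
      z (comp i) xor z (comp j)         ≡⟨ cong (λ x → z x xor z (comp j)) (comp-complete i j ((a , degree-two 3≰deg , Hai , Haj) ◅ ε)) ⟩
      z (comp j) xor z (comp j)         ≡⟨ xor-same (z (comp j)) ⟩
      false                             ∎
      where open ≡-Reasoning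

  kernel-constant : ∀ y → InKer H y → ∀ {i j} → Conn2 H i j → y i ≡ y j
  kernel-constant y y∈ker ε                          = refl
  kernel-constant y y∈ker (step ◅ path) = trans (across step) (kernel-constant y y∈ker path)
    where
    across : ∀ {i j} → Adj2 H i j → y i ≡ y j
    across {i} {j} (a , deg≡2 , Hai , Haj) with i ≟ j
    ... | yes refl = refl
    ... | no  i≢j  = xor-false⇒≡ (trans (sym (degree-two-sum deg≡2 i≢j Hai Haj y)) (y∈ker a))

  representative : Fin nS → Fin n
  representative v = proj₁ (comp-surj v)

  kernel-via-representatives : ∀ y → InKer H y → ∀ i → y i ≡ y (representative (comp i))
  kernel-via-representatives y y∈ker i =
    sym (kernel-constant y y∈ker (comp-sound _ i (proj₂ (comp-surj (comp i)))))

  pushforward-kernel : ∀ y → InKer H y → InKer Q (λ v → y (representative v))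
  pushforward-kernel y y∈ker b =
    trans (sym (H-collapses-to-Q b (λ v → y (representative v))))
          (trans (xorSum-cong (λ i → cong (H (fS b) i ∧_) (sym (kernel-via-representatives y y∈ker i))))
                 (y∈ker (fS b)))

  size-by-fibres : ∀ (B : Fin nS → Bool) → natSum (λ v → if B v then size v else 0) ≡ count (λ i → B (comp i))
  size-by-fibres B = begin
    natSum (λ v → if B v then size v else 0)             ≡⟨ natSum-cong restrict ⟩
    natSum (λ v → natSum (λ i → ind (B v ∧ L i v)))      ≡⟨ natSum-swap (λ v i → ind (B v ∧ L i v)) ⟩
    natSum (λ i → natSum (λ v → ind (B v ∧ L i v)))      ≡⟨ natSum-cong (λ i → natSum-single _ (comp i) (off-fibre i)) ⟩
    natSum (λ i → ind (B (comp i) ∧ L i (comp i)))       ≡⟨ natSum-cong (λ i → cong (λ x → ind (B (comp i) ∧ x)) (δ-refl (comp i))) ⟩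
    natSum (λ i → ind (B (comp i) ∧ true))               ≡⟨ natSum-cong (λ i → cong ind (∧-identityʳ (B (comp i)))) ⟩
    count (λ i → B (comp i))                             ∎
    where
    open ≡-Reasoning
    restrict : ∀ v → (if B v then size v else 0) ≡ natSum (λ i → ind (B v ∧ L i v))
    restrict v with B v
    ... | true  = refl
    ... | false = sym (natSum-zero {n} (λ i → 0) (λ i → refl))
    off-fibre : ∀ i v → v ≢ comp i → ind (B v ∧ L i v) ≡ 0
    off-fibre i v v≢ rewrite δ-≢ (λ eq → v≢ (sym eq)) = cong ind (∧-zeroʳ (B v))

  module KernelBasis {u : Fin mS → Fin nS} {M : Mat mS mS}
      (right-inverse : ∀ a b → ((λ a b → Q a (u b)) ⊛ M) a b ≡ δ a b)
      (left-inverse  : ∀ a b → (M ⊛ (λ a b → Q a (u b))) a b ≡ δ a b) where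
    open SystematicBasis Q u M right-inverse left-inverse
    open Choice u using (SparseKernelBasis)

    in-kernel : ∀ w → inW w ≡ true → InKer H (expand (column w))
    in-kernel w _ = pullback-kernel (column w) (column-kernel w)

    independent : ∀ (c : Fin nS → Bool) → (∀ i → xorSum (λ w → inW w ∧ c w ∧ expand (column w) i) ≡ false) →
      ∀ w → inW w ≡ true → c w ≡ false
    independent c c·basis≡0 w w∈W with comp-surj w
    ... | i , refl = begin
      c (comp i)                                              ≡⟨ combination-on-W c w∈W ⟨
      combination c (comp i)                                  ≡⟨ xorSum-cong (λ w' → cong (λ x → inW w' ∧ c w' ∧ x) (sym (expand-comp (column w') i))) ⟩
      xorSum (λ w' → inW w' ∧ c w' ∧ expand (column w') i)    ≡⟨ c·basis≡0 i ⟩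
      false                                                   ∎
      where open ≡-Reasoning

    spanning : ∀ y → InKer H y → ∃ λ (c : Fin nS → Bool) → ∀ i → y i ≡ xorSum (λ w → inW w ∧ c w ∧ expand (column w) i)
    spanning y y∈ker = y∘rep , λ i → begin
      y i                                                     ≡⟨ kernel-via-representatives y y∈ker i ⟩
      y∘rep (comp i)                                          ≡⟨ kernel-spanned y∘rep (pushforward-kernel y y∈ker) (comp i) ⟩
      combination y∘rep (comp i)                              ≡⟨ xorSum-cong (λ w → cong (λ x → inW w ∧ y∘rep w ∧ x) (sym (expand-comp (column w) i))) ⟩
      xorSum (λ w → inW w ∧ y∘rep w ∧ expand (column w) i)    ∎
      where
      open ≡-Reasoning
      y∘rep : Fin nS → Bool
      y∘rep v = y (representative v)

    sparse : ∀ t → (∀ w v → column w v ≡ true → ball w t v ≡ true) → ∀ w → count (expand (column w)) ≤ sBound t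
    sparse t local w = begin
      count (expand (column w))         ≡⟨ natSum-cong (λ i → cong ind (expand-comp (column w) i)) ⟩
      count (λ i → column w (comp i))   ≤⟨ count-mono (λ i → local w (comp i)) ⟩
      count (λ i → ball w t (comp i))   ≡⟨ size-by-fibres (ball w t) ⟨
      S w t                             ≤⟨ maxOver-≥ (λ v → S v t) w ⟩
      sBound t                          ∎
      where open ≤-Reasoning

    kernel-basis : ∀ t → (∀ w v → column w v ≡ true → ball w t v ≡ true) → SparseKernelBasis M (sBound t)
    kernel-basis t local = in-kernel , independent , spanning , λ w _ → sparse t local w

lemma3p4 : ∀ {m n} (H : Fin m → Fin n → Bool) →
    (∀ a → 2 ≤ checkDeg H a) →
    (C : Collapsed H) →
    let open Lemma H C in
    (T : ℕ) → IsTC T → NoCore T →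
    (u : Fin mS → Fin nS) → ValidChoice T u →
    let open Choice u in
    Σ (Fin mS → Fin mS → Bool) λ M →
      (∀ a b → (QU ⊛ M) a b ≡ δ a b) × (∀ a b → (M ⊛ QU) a b ≡ δ a b)
      × SparseKernelBasis M (sBound T)
lemma3p4 H deg≥2 C T _ _ u valid =
  geo T , proj₁ Qu-inverse , proj₂ Qu-inverse , kernel-basis T column-local
  where
  open Lemma H C using (Q)
  open PeeledBasis Q valid using (offDiag; Qu-inverse; column-local)
  open Neumann offDiag using (geo)
  open Collapse H deg≥2 C using (module KernelBasis)
  open KernelBasis (proj₁ Qu-inverse) (proj₂ Qu-inverse) using (kernel-basis)
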